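{- Let $G$ be a finite graph on vertex set $V$ with vertex cover number $\tau$. Then for every integer $m$, the number of vertex covers of $G$ having exactly $m$ vertices is at most $2^{\tau}\binom{|V|-\tau}{m-\tau}$.
   Context: A vertex cover of a graph is a set $C$ of vertices such that every edge has at least one endpoint in $C$; the vertex cover number is the minimum size of a vertex cover. Binomial coefficients $\binom{a}{b}$ with $b<0$ are $0$. -}

module Defs where

open import Data.Nat using (ℕ; zero; suc; _≤_)
open import Data.Integer using (ℤ; +_; -[1+_]; _-_)
open import Data.Nat.Combinatorics using (_C_)
open import Data.Bool using (Bool; true; false; T)
open import Data.Fin using (Fin)
open import Data.Fin.Subset using (Subset; inside; outside; _∈_; ∣_∣)
open import Data.Fin.Subset.Properties using (_∈?_)
open import Data.Fin.Properties using (all?)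
open import Data.Vec using (Vec; []; _∷_)
open import Data.List using (List; []; _∷_; _++_; map; filter; length)
open import Data.Sum using (_⊎_)
open import Data.Product using (Σ; _×_)
open import Relation.Nullary using (Dec; ¬_)
open import Relation.Nullary.Decidable using (_⊎-dec_; _→-dec_; _×-dec_)
open import Relation.Binary.PropositionalEquality using (_≡_)

record Graph (n : ℕ) : Set where
  field
    adj       : Fin n → Fin n → Bool
    adj-sym   : ∀ u v → adj u v ≡ adj v u
    adj-irrefl : ∀ v → adj v v ≡ false

open Graph public

Edge : ∀ {n} → Graph n → Fin n → Fin n → Set
Edge G u v = T (adj G u v)

IsVertexCover : ∀ {n} → Graph n → Subset n → Set
IsVertexCover G C = ∀ u v → Edge G u v → u ∈ C ⊎ v ∈ C

IsVertexCoverNumber : ∀ {n} → Graph n → ℕ → Set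
IsVertexCoverNumber G τ =
  Σ (Subset _) (λ C → IsVertexCover G C × ∣ C ∣ ≡ τ)
  × (∀ C → IsVertexCover G C → τ ≤ ∣ C ∣)

private
  T? : ∀ b → Dec (T b)
  T? true  = Relation.Nullary.yes _
  T? false = Relation.Nullary.no (λ ())

isVertexCover? : ∀ {n} (G : Graph n) (C : Subset n) → Dec (IsVertexCover G C)
isVertexCover? G C =
  all? (λ u → all? (λ v → T? (adj G u v) →-dec ((u ∈? C) ⊎-dec (v ∈? C))))

allSubsets : ∀ n → List (Subset n)
allSubsets zero    = [] ∷ []
allSubsets (suc n) =
  map (inside ∷_) (allSubsets n) ++ map (outside ∷_) (allSubsets n)

numCoversOfSize : ∀ {n} → Graph n → ℕ → ℕ
numCoversOfSize {n} G m =
  length (filter (λ C → isVertexCover? G C ×-dec (∣ C ∣ Data.Nat.≟ m))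
                 (allSubsets n))
  where import Data.Nat

binomℤ : ℕ → ℤ → ℕ
binomℤ a (+ b)     = a C b
binomℤ a -[1+ _ ]  = 0

numCoversOfSizeℤ : ∀ {n} → Graph n → ℤ → ℕ
numCoversOfSizeℤ G (+ m)    = numCoversOfSize G m
numCoversOfSizeℤ G -[1+ _ ] = 0

-- Fix a minimum vertex cover c, so ∣ c ∣ = τ, and sort the covers W by their trace W ∩ c, of
-- which there are at most 2 ^ τ.  A cover with trace t contains t together with every
-- neighbour of c ∖ t; this forced set is itself a vertex cover, so it has at least τ
-- elements.  The covers of size m with trace t are therefore among the m-sets containing a
-- fixed set of size l ≥ τ, and there are C(n − l, m − l) ≤ C(n − τ, m − τ) of those.

module Submission where

open import Data.Bool using (T)
open import Data.Bool.Properties using (T?; T-≡)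
open import Data.Fin using (Fin)
open import Data.Fin.Properties using (any?)
open import Data.Fin.Subset using (Subset; inside; outside; _∈_; _⊆_; _∩_; _∪_; ∁; ∣_∣)
open import Data.Fin.Subset.Properties
  using (_⊆?_; _∈?_; drop-∷-⊆; p⊆q⇒∣p∣≤∣q∣; ∣p∣≤n; ∣∁p∣≡n∸∣p∣; p∩q⊆q;
         x∈p∩q⁺; x∈p∩q⁻; x∈p∪q⁺; x∈p∪q⁻; x∉p⇒x∈∁p; x∈∁p⇒x∉p)
open import Data.Integer using (ℤ; +_; -[1+_]; _-_)
open import Data.Integer.Properties using ([+m]-[+n]≡m⊖n; ⊖-≥)
open import Data.List using (List; []; _∷_; _++_; map; filter; length)
open import Data.List.Properties using (length-++; filter-++; filter-none)
open import Data.List.Membership.Propositional using (lose) renaming (_∈_ to _∈ₗ_)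
open import Data.List.Membership.Propositional.Properties using (∈-++⁺ˡ; ∈-++⁺ʳ; ∈-map⁺; ∈-filter⁺)
open import Data.List.Relation.Unary.All using (universal)
open import Data.List.Relation.Unary.Any using (Any; here; there)
open import Data.List.Relation.Unary.Any.Properties using (¬Any[])
open import Data.Nat
open import Data.Nat.Combinatorics using (_C_; nCk+nC[k+1]≡[n+1]C[k+1])
open import Data.Nat.Properties
open import Data.Product using (∃; _×_; _,_; proj₁)
open import Data.Sum using (_⊎_; inj₁; inj₂; swap)
open import Data.Vec using ([]; _∷_; tabulate; here)
open import Data.Vec.Properties using (lookup∘tabulate; lookup⇒[]=; []=⇒lookup)
open import Function using (_∘_; case_of_; Equivalence)
open import Level using (0ℓ)
open import Relation.Nullary using (¬_; Dec; yes; no; contradiction)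
open import Relation.Nullary.Decidable using (_×-dec_; ¬?; isYes; toWitness; fromWitness)
open import Relation.Unary using (Pred; Decidable)
open import Relation.Binary.PropositionalEquality

open import Defs

module _ {A : Set} where

  count : {P : Pred A 0ℓ} → Decidable P → List A → ℕ
  count P? xs = length (filter P? xs)

  module _ {P Q : Pred A 0ℓ} (P? : Decidable P) (Q? : Decidable Q) where

    count-mono : (∀ {x} → P x → Q x) → ∀ xs → count P? xs ≤ count Q? xs
    count-mono P⇒Q [] = z≤n
    count-mono P⇒Q (x ∷ xs) with P? x | Q? x
    ... | yes _ | yes _ = s≤s (count-mono P⇒Q xs)
    ... | yes p | no ¬q = contradiction (P⇒Q p) ¬q
    ... | no _  | yes _ = m≤n⇒m≤1+n (count-mono P⇒Q xs)
    ... | no _  | no _  = count-mono P⇒Q xs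

    count-split : ∀ xs → count P? xs ≤ count Q? xs + count (λ x → P? x ×-dec ¬? (Q? x)) xs
    count-split [] = z≤n
    count-split (x ∷ xs) with P? x | Q? x
    ... | yes _ | yes _ = s≤s (count-split xs)
    ... | yes _ | no _  = ≤-trans (s≤s (count-split xs)) (≤-reflexive (sym (+-suc _ _)))
    ... | no _  | yes _ = m≤n⇒m≤1+n (count-split xs)
    ... | no _  | no _  = count-split xs

  module _ {P : Pred A 0ℓ} (P? : Decidable P) where

    count-none : (∀ x → ¬ P x) → ∀ xs → count P? xs ≡ 0
    count-none ¬P xs = cong length (filter-none P? (universal ¬P xs))

    count-++ : ∀ xs ys → count P? (xs ++ ys) ≡ count P? xs + count P? ys
    count-++ xs ys = trans (cong length (filter-++ P? xs ys)) (length-++ (filter P? xs))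

  union-bound : ∀ {P : Pred A 0ℓ} (P? : Decidable P) {B : Set} {Q : B → Pred A 0ℓ}
                (Q? : ∀ t → Decidable (Q t)) (ts : List B) xs {K : ℕ} →
                (∀ {x} → P x → Any (λ t → Q t x) ts) → (∀ t → count (Q? t) xs ≤ K) →
                count P? xs ≤ length ts * K
  union-bound P? Q? [] xs covered bounded =
    ≤-reflexive (count-none P? (λ _ p → ¬Any[] (covered p)) xs)
  union-bound {P} P? {Q = Q} Q? (t ∷ ts) xs {K} covered bounded = begin
    count P? xs                      ≤⟨ count-split P? (Q? t) xs ⟩
    count (Q? t) xs + count P∖Q? xs  ≤⟨ +-mono-≤ (bounded t) (union-bound P∖Q? Q? ts xs covered′ bounded) ⟩
    K + length ts * K                ∎
    where
    open ≤-Reasoning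
    P∖Q? = λ x → P? x ×-dec ¬? (Q? t x)
    covered′ : ∀ {x} → P x × ¬ Q t x → Any (λ t → Q t x) ts
    covered′ (p , ¬q) with covered p
    ... | here q   = contradiction q ¬q
    ... | there qs = qs

count-map : ∀ {A B : Set} {P : Pred A 0ℓ} (P? : Decidable P) (f : B → A) xs →
            count P? (map f xs) ≡ count (P? ∘ f) xs
count-map P? f [] = refl
count-map P? f (x ∷ xs) with P? (f x)
... | yes _ = cong suc (count-map P? f xs)
... | no _  = count-map P? f xs

∈-allSubsets : ∀ {n} (p : Subset n) → p ∈ₗ allSubsets n
∈-allSubsets []            = here refl
∈-allSubsets (inside ∷ p)  = ∈-++⁺ˡ (∈-map⁺ (inside ∷_) (∈-allSubsets p))
∈-allSubsets (outside ∷ p) = ∈-++⁺ʳ _ (∈-map⁺ (outside ∷_) (∈-allSubsets p))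

count-allSubsets-suc : ∀ {n} {P : Pred (Subset (suc n)) 0ℓ} (P? : Decidable P) →
  count P? (allSubsets (suc n)) ≡
  count (P? ∘ (inside ∷_)) (allSubsets n) + count (P? ∘ (outside ∷_)) (allSubsets n)
count-allSubsets-suc {n} P? = begin
  count P? (map (inside ∷_) (allSubsets n) ++ map (outside ∷_) (allSubsets n))
    ≡⟨ count-++ P? (map (inside ∷_) (allSubsets n)) _ ⟩
  count P? (map (inside ∷_) (allSubsets n)) + count P? (map (outside ∷_) (allSubsets n))
    ≡⟨ cong₂ _+_ (count-map P? (inside ∷_) (allSubsets n)) (count-map P? (outside ∷_) (allSubsets n)) ⟩
  count (P? ∘ (inside ∷_)) (allSubsets n) + count (P? ∘ (outside ∷_)) (allSubsets n) ∎
  where open ≡-Reasoning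

count-allSubsets-suc-≤ : ∀ {n} {P : Pred (Subset (suc n)) 0ℓ} (P? : Decidable P) {a b} →
  count (P? ∘ (inside ∷_)) (allSubsets n) ≤ a → count (P? ∘ (outside ∷_)) (allSubsets n) ≤ b →
  count P? (allSubsets (suc n)) ≤ a + b
count-allSubsets-suc-≤ P? ≤a ≤b = ≤-trans (≤-reflexive (count-allSubsets-suc P?)) (+-mono-≤ ≤a ≤b)

count-subsets : ∀ {n} (c : Subset n) → count (_⊆? c) (allSubsets n) ≤ 2 ^ ∣ c ∣
count-subsets []                    = ≤-refl
count-subsets {suc n} (inside ∷ c)  =
  count-allSubsets-suc-≤ (_⊆? inside ∷ c) tails⊆c (≤-trans tails⊆c (m≤m+n _ 0))
  where
  tails⊆c : ∀ {s} → count (λ t → s ∷ t ⊆? inside ∷ c) (allSubsets n) ≤ 2 ^ ∣ c ∣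
  tails⊆c = ≤-trans (count-mono _ (_⊆? c) drop-∷-⊆ (allSubsets n)) (count-subsets c)
count-subsets {suc n} (outside ∷ c) =
  count-allSubsets-suc-≤ (_⊆? outside ∷ c)
    (≤-reflexive (count-none _ (λ t t⊆c → case t⊆c here of λ ()) (allSubsets n)))
    (≤-trans (count-mono _ (_⊆? c) drop-∷-⊆ (allSubsets n)) (count-subsets c))

superset-of-size? : ∀ {n} (lo : Subset n) (k : ℕ) → Decidable (λ X → lo ⊆ X × ∣ X ∣ ≡ k)
superset-of-size? lo k X = lo ⊆? X ×-dec ∣ X ∣ ≟ k

count-supersets : ∀ {n} (lo : Subset n) j →
                  count (superset-of-size? lo (∣ lo ∣ + j)) (allSubsets n) ≤ ∣ ∁ lo ∣ C j
count-supersets []                    zero    = ≤-refl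
count-supersets []                    (suc j) = ≤-refl
count-supersets {suc n} (inside ∷ lo) j       =
  ≤-trans (count-allSubsets-suc-≤ (superset-of-size? (inside ∷ lo) (suc (∣ lo ∣ + j)))
            (≤-trans (count-mono _ (superset-of-size? lo (∣ lo ∣ + j))
                                 (λ (lo⊆X , ∣X∣≡) → drop-∷-⊆ lo⊆X , suc-injective ∣X∣≡) (allSubsets n))
                     (count-supersets lo j))
            (≤-reflexive (count-none _ (λ X (lo⊆X , _) → case lo⊆X here of λ ()) (allSubsets n))))
          (≤-reflexive (+-identityʳ _))
count-supersets {suc n} (outside ∷ lo) zero   =
  count-allSubsets-suc-≤ (superset-of-size? (outside ∷ lo) (∣ lo ∣ + 0))
    (≤-reflexive (count-none _ too-small (allSubsets n)))
    (≤-trans (count-mono _ (superset-of-size? lo (∣ lo ∣ + 0))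
                         (λ (lo⊆X , ∣X∣≡) → drop-∷-⊆ lo⊆X , ∣X∣≡) (allSubsets n))
             (count-supersets lo 0))
  where
  too-small : ∀ X → ¬ (outside ∷ lo ⊆ inside ∷ X × suc ∣ X ∣ ≡ ∣ lo ∣ + 0)
  too-small X (lo⊆X , ∣X∣≡) =
    <⇒≱ (≤-reflexive (trans ∣X∣≡ (+-identityʳ _))) (p⊆q⇒∣p∣≤∣q∣ (drop-∷-⊆ lo⊆X))
count-supersets {suc n} (outside ∷ lo) (suc j) =
  ≤-trans (count-allSubsets-suc-≤ (superset-of-size? (outside ∷ lo) (∣ lo ∣ + suc j))
            (≤-trans (count-mono _ (superset-of-size? lo (∣ lo ∣ + j))
                                 (λ (lo⊆X , ∣X∣≡) → drop-∷-⊆ lo⊆X , suc-injective (trans ∣X∣≡ (+-suc _ _)))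
                                 (allSubsets n))
                     (count-supersets lo j))
            (≤-trans (count-mono _ (superset-of-size? lo (∣ lo ∣ + suc j))
                                 (λ (lo⊆X , ∣X∣≡) → drop-∷-⊆ lo⊆X , ∣X∣≡) (allSubsets n))
                     (count-supersets lo (suc j))))
          (≤-reflexive (nCk+nC[k+1]≡[n+1]C[k+1] ∣ ∁ lo ∣ j))

count-supersets-below : ∀ {n} (lo : Subset n) {k} → k < ∣ lo ∣ →
                        count (superset-of-size? lo k) (allSubsets n) ≡ 0
count-supersets-below {n} lo {k} k<∣lo∣ = count-none (superset-of-size? lo k) too-small (allSubsets n)
  where
  too-small : ∀ X → ¬ (lo ⊆ X × ∣ X ∣ ≡ k)
  too-small X (lo⊆X , ∣X∣≡k) = <⇒≱ k<∣lo∣ (subst (∣ lo ∣ ≤_) ∣X∣≡k (p⊆q⇒∣p∣≤∣q∣ lo⊆X))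

nCk≤[e+n]C[e+k] : ∀ e n k → n C k ≤ (e + n) C (e + k)
nCk≤[e+n]C[e+k] zero    n k = ≤-refl
nCk≤[e+n]C[e+k] (suc e) n k = begin
  n C k                                       ≤⟨ nCk≤[e+n]C[e+k] e n k ⟩
  (e + n) C (e + k)                           ≤⟨ m≤m+n _ _ ⟩
  (e + n) C (e + k) + (e + n) C suc (e + k)   ≡⟨ nCk+nC[k+1]≡[n+1]C[k+1] (e + n) (e + k) ⟩
  suc (e + n) C suc (e + k)                   ∎
  where open ≤-Reasoning

[n∸l]Cj≤[n∸t]C[l+j∸t] : ∀ {n l t} j → t ≤ l → l ≤ n → (n ∸ l) C j ≤ (n ∸ t) C (l + j ∸ t)
[n∸l]Cj≤[n∸t]C[l+j∸t] {t = t} j t≤l l≤n with m≤n⇒∃[o]m+o≡n t≤l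
... | e , refl with m≤n⇒∃[o]m+o≡n l≤n
... | r , refl = begin
  (t + e + r ∸ (t + e)) C j   ≡⟨ cong (_C j) (m+n∸m≡n (t + e) r) ⟩
  r C j                       ≤⟨ nCk≤[e+n]C[e+k] e r j ⟩
  (e + r) C (e + j)           ≡⟨ cong₂ _C_ (sym (cancel r)) (sym (cancel j)) ⟩
  (t + e + r ∸ t) C (t + e + j ∸ t) ∎
  where
  open ≤-Reasoning
  cancel : ∀ x → t + e + x ∸ t ≡ e + x
  cancel x = trans (cong (_∸ t) (+-assoc t e x)) (m+n∸m≡n t (e + x))

count-supersets≤[n∸τ]C[k∸τ] : ∀ {n} (lo : Subset n) {τ} → τ ≤ ∣ lo ∣ → ∀ k →
                              count (superset-of-size? lo k) (allSubsets n) ≤ (n ∸ τ) C (k ∸ τ)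
count-supersets≤[n∸τ]C[k∸τ] {n} lo {τ} τ≤∣lo∣ k with k <? ∣ lo ∣
... | yes k<∣lo∣ = ≤-trans (≤-reflexive (count-supersets-below lo k<∣lo∣)) z≤n
... | no  k≮∣lo∣ with m≤n⇒∃[o]m+o≡n (≮⇒≥ k≮∣lo∣)
... | j , refl = begin
  count (superset-of-size? lo (∣ lo ∣ + j)) (allSubsets n) ≤⟨ count-supersets lo j ⟩
  ∣ ∁ lo ∣ C j                                             ≡⟨ cong (_C j) (∣∁p∣≡n∸∣p∣ lo) ⟩
  (n ∸ ∣ lo ∣) C j                                         ≤⟨ [n∸l]Cj≤[n∸t]C[l+j∸t] j τ≤∣lo∣ (∣p∣≤n lo) ⟩
  (n ∸ τ) C (∣ lo ∣ + j ∸ τ)                               ∎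
  where open ≤-Reasoning

module _ {n} (G : Graph n) where

  adjacent? : (S : Subset n) (v : Fin n) → Dec (∃ λ u → u ∈ S × Edge G u v)
  adjacent? S v = any? (λ u → u ∈? S ×-dec T? (adj G u v))

  neighbours : Subset n → Subset n
  neighbours S = tabulate (isYes ∘ adjacent? S)

  ∈-neighbours⁺ : ∀ {S u v} → u ∈ S → Edge G u v → v ∈ neighbours S
  ∈-neighbours⁺ {S} {u} {v} u∈S e =
    lookup⇒[]= v (neighbours S)
      (trans (lookup∘tabulate _ v) (Equivalence.to T-≡ (fromWitness (u , u∈S , e))))

  ∈-neighbours⁻ : ∀ {S v} → v ∈ neighbours S → ∃ λ u → u ∈ S × Edge G u v
  ∈-neighbours⁻ {S} {v} v∈N =
    toWitness (Equivalence.from T-≡ (trans (sym (lookup∘tabulate _ v)) ([]=⇒lookup v∈N)))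

  forced : Subset n → Subset n → Subset n
  forced c t = t ∪ neighbours (c ∩ ∁ t)

  forced-⊆ : ∀ {W} c → IsVertexCover G W → forced c (W ∩ c) ⊆ W
  forced-⊆ {W} c W-cover v∈forced with x∈p∪q⁻ (W ∩ c) _ v∈forced
  ... | inj₁ v∈W∩c = proj₁ (x∈p∩q⁻ W c v∈W∩c)
  ... | inj₂ v∈N with ∈-neighbours⁻ v∈N
  ... | u , u∈c∖W , e with x∈p∩q⁻ c _ u∈c∖W
  ... | u∈c , u∉W∩c with W-cover u _ e
  ... | inj₁ u∈W = contradiction (x∈p∩q⁺ (u∈W , u∈c)) (x∈∁p⇒x∉p u∉W∩c)
  ... | inj₂ v∈W = v∈W

  forced-covers-edge-from : ∀ {c u v} t → u ∈ c → Edge G u v → u ∈ forced c t ⊎ v ∈ forced c t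
  forced-covers-edge-from {u = u} t u∈c e with u ∈? t
  ... | yes u∈t = inj₁ (x∈p∪q⁺ (inj₁ u∈t))
  ... | no  u∉t = inj₂ (x∈p∪q⁺ (inj₂ (∈-neighbours⁺ (x∈p∩q⁺ (u∈c , x∉p⇒x∈∁p u∉t)) e)))

  forced-isVertexCover : ∀ {c} t → IsVertexCover G c → IsVertexCover G (forced c t)
  forced-isVertexCover t c-cover u v e with c-cover u v e
  ... | inj₁ u∈c = forced-covers-edge-from t u∈c e
  ... | inj₂ v∈c = swap (forced-covers-edge-from t v∈c (subst T (adj-sym G u v) e))

lemma9 : ∀ {n : ℕ} (G : Graph n) (τ : ℕ) → IsVertexCoverNumber G τ →
           (m : ℤ) → numCoversOfSizeℤ G m ≤ 2 ^ τ * binomℤ (n ∸ τ) (m - + τ)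
lemma9 G τ _ -[1+ _ ] = z≤n
lemma9 {n} G τ ((c , c-cover , ∣c∣≡τ) , minimal) (+ m) with τ ≤? m
... | no τ≰m = ≤-trans (≤-reflexive (count-none cover? too-small (allSubsets n))) z≤n
  where
  cover? = λ W → isVertexCover? G W ×-dec (∣ W ∣ ≟ m)
  too-small : ∀ W → ¬ (IsVertexCover G W × ∣ W ∣ ≡ m)
  too-small W (W-cover , ∣W∣≡m) = τ≰m (subst (τ ≤_) ∣W∣≡m (minimal W W-cover))
... | yes τ≤m rewrite [+m]-[+n]≡m⊖n m τ | ⊖-≥ τ≤m = begin
  count cover? (allSubsets n) ≤⟨ union-bound cover? (λ t → superset-of-size? (forced G c t) m)
                                             subsets-of-c (allSubsets n) fibre bounded ⟩
  length subsets-of-c * B     ≤⟨ *-monoˡ-≤ B (subst (λ k → length subsets-of-c ≤ 2 ^ k) ∣c∣≡τ (count-subsets c)) ⟩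
  2 ^ τ * B                   ∎
  where
  open ≤-Reasoning
  cover? = λ W → isVertexCover? G W ×-dec (∣ W ∣ ≟ m)
  subsets-of-c = filter (_⊆? c) (allSubsets n)
  B = (n ∸ τ) C (m ∸ τ)
  fibre : ∀ {W} → IsVertexCover G W × ∣ W ∣ ≡ m →
          Any (λ t → forced G c t ⊆ W × ∣ W ∣ ≡ m) subsets-of-c
  fibre {W} (W-cover , ∣W∣≡m) =
    lose (∈-filter⁺ (_⊆? c) (∈-allSubsets (W ∩ c)) (p∩q⊆q W c)) (forced-⊆ G c W-cover , ∣W∣≡m)
  bounded : ∀ t → count (superset-of-size? (forced G c t) m) (allSubsets n) ≤ B
  bounded t = count-supersets≤[n∸τ]C[k∸τ] (forced G c t) (minimal _ (forced-isVertexCover G t c-cover)) m
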